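{- Let $p,q\ge1$ be integers and let $\lambda=(\lambda_1,\dots,\lambda_p)$ be a partition with $\lambda\subseteq p\times q$ (i.e., at most $p$ nonzero parts, each at most $q$). Define $\tilde{\lambda}=(\tilde{\lambda}_1,\dots,\tilde{\lambda}_p)$ by $\tilde{\lambda}_i=q-\lambda_{p+1-i}$ (with $\lambda_j=0$ for parts beyond the length of $\lambda$). Then $$H_{p\times q}=(-1)^{|\lambda|}H_\lambda H_{\tilde{\lambda}}\, s_\lambda(1^p)\, s_\lambda(1^{ -q}).$$
   Context: A partition $\lambda$ is identified with its diagram $\{(i,j): 1\le j\le\lambda_i\}$, whose elements are called squares; $\lambda'$ denotes the conjugate partition and $|\lambda|$ the sum of the parts. The hook length of $u=(i,j)\in\lambda$ is $h(u)=\lambda_i+\lambda'_j-i-j+1$, and its content is $c(u)=j-i$. $H_\lambda=\prod_{u\in\lambda}h(u)$ (equal to $1$ for the empty partition). $p\times q$ denotes the partition with exactly $p$ parts all equal to $q$. $s_\lambda(1^p)$ is the Schur function $s_\lambda$ evaluated at $x_1=\cdots=x_p=1$, $x_i=0$ for $i>p$, which equals $\prod_{u\in\lambda}\frac{p+c(u)}{h(u)}$; and by definition $s_\lambda(1^{ -q})=\prod_{u\in\lambda}\frac{ -q+c(u)}{h(u)}$. -}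

module Defs where

open import Data.Nat as ℕ using (ℕ; zero; suc; _∸_; _≤_; _≤ᵇ_)
open import Data.Integer as ℤ using (ℤ; +_; -[1+_])
open import Data.Rational as ℚ using (ℚ)
open import Data.Nat.ListAction using (sum)
open import Data.List using (List; []; _∷_; length; filter; map; concat; foldr; reverse; replicate)
open import Data.List.Relation.Unary.All using (All)
open import Data.List.Relation.Unary.Linked using (Linked)
open import Data.Product using (_×_; _,_)
open import Data.Bool using (Bool; true; false; if_then_else_)

-- A partition is a weakly decreasing list of natural numbers
-- (trailing zero parts are allowed and do not affect the diagram).
IsPartition : List ℕ → Set
IsPartition λs = Linked (λ a b → b ≤ a) λs

-- λ_i, 1-indexed, with λ_i = 0 beyond the length of the list.
part : List ℕ → ℕ → ℕ
part []       _             = 0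
part (x ∷ xs) zero          = 0
part (x ∷ xs) (suc zero)    = x
part (x ∷ xs) (suc (suc i)) = part xs (suc i)

count≥ : ℕ → List ℕ → ℕ
count≥ j []       = 0
count≥ j (x ∷ xs) = (if j ≤ᵇ x then 1 else 0) ℕ.+ count≥ j xs

conj : List ℕ → ℕ → ℕ
conj λs j = count≥ j λs

range1 : ℕ → List ℕ
range1 zero    = []
range1 (suc n) = Data.List._++_ (range1 n) (suc n ∷ [])

squares : List ℕ → List (ℕ × ℕ)
squares λs = concat (map (λ i → map (λ j → (i , j)) (range1 (part λs i))) (range1 (length λs)))

size : List ℕ → ℕ
size = sum

-- hook length h(i,j) = λ_i + λ'_j - i - j + 1, written as
-- 1 + (λ_i - j) + (λ'_j - i), which agrees with it on squares of λ.
hook : List ℕ → ℕ × ℕ → ℕ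
hook λs (i , j) = suc ((part λs i ∸ j) ℕ.+ (conj λs j ∸ i))

content : ℕ × ℕ → ℤ
content (i , j) = (+ j) ℤ.- (+ i)

H : List ℕ → ℕ
H λs = foldr (λ u r → hook λs u ℕ.* r) 1 (squares λs)

prodℚ : List ℚ → ℚ
prodℚ = foldr ℚ._*_ ℚ.1ℚ

-- s_λ evaluated "at 1^z" for an integer z: ∏_{u ∈ λ} (z + c(u)) / h(u).
-- For z = p this is s_λ(1^p); for z = -q it is s_λ(1^{-q}) by definition.
sEval : List ℕ → ℤ → ℚ
sEval λs z = prodℚ (map (λ u → (z ℤ.+ content u) ℚ./ hook λs u) (squares λs))

rect : ℕ → ℕ → List ℕ
rect p q = replicate p q

-- complement: λ̃_i = q - λ_{p+1-i}, for λ given as a list of length p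
complement : ℕ → List ℕ → List ℕ
complement q λs = map (q ∸_) (reverse λs)

toℚ : ℕ → ℚ
toℚ n = (+ n) ℚ./ 1

-- Write l_i = λ_i + (p − i) for the shifted parts of λ and Δ(l) = ∏_{i<j} (l_i − l_j).
-- The hook lengths of the first row of λ together with the gaps l_1 − l_j (j > 1) are exactly
-- 1, …, l_1; peeling off rows this way gives Frobenius' formula H_λ · Δ(l) = ∏ l_i!.
-- The shifted parts of λ̃ are the numbers q + p − 1 − l_i in reverse order, so λ̃ has the same
-- Vandermonde product as λ, and those of p × q are q + p − 1, …, q.  Row by row,
-- ∏_u (p + c(u)) · ∏_{k<p} k! = ∏ l_i!  and  ∏_u (q − c(u)) · ∏ (q + p − 1 − l_i)! = ∏_{k<p} (q + k)!.
-- Together these give H_{p×q} H_λ = H_λ̃ ∏_u (p + c(u)) ∏_u (q − c(u)), and by definition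
-- ∏_u (p + c(u)) = H_λ s_λ(1^p) and ∏_u (q − c(u)) = (−1)^{|λ|} H_λ s_λ(1^{−q}).

module Submission where

open import Defs
open import Data.List using (List; []; _∷_; _++_; _∷ʳ_; length; map; concat; foldr; reverse; replicate; upTo; downFrom; applyUpTo)
open import Data.List.Properties
  using ( map-++; map-∘; map-cong; map-cong-local; map-id; concat-map; foldr-map; ++-assoc; ++-identityʳ
        ; applyUpTo-∷ʳ; map-applyUpTo; length-applyUpTo; length-++; length-map; length-replicate
        ; unfold-reverse; reverse-map; reverse-upTo; map-upTo )
open import Data.List.Relation.Unary.All as All using (All; []; _∷_)
import Data.List.Relation.Unary.All.Properties as All
open import Data.List.Relation.Unary.AllPairs as AllPairs using (AllPairs; []; _∷_)
import Data.List.Relation.Unary.AllPairs.Properties as AllPairs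
open import Data.List.Relation.Unary.Linked.Properties using (Linked⇒AllPairs)
open import Data.List.Relation.Binary.Permutation.Propositional using (↭-sym)
open import Data.List.Relation.Binary.Permutation.Propositional.Properties using (↭-reverse; All-resp-↭)
import Data.List.Relation.Binary.Permutation.Propositional.Properties as Perm
open import Data.Product using (_×_; _,_; proj₁; proj₂; map₁)
open import Function using (_∘_; flip)
open import Relation.Binary.PropositionalEquality

module HookLengthProducts where

  open import Data.Nat as ℕ using (ℕ; zero; suc; _+_; _*_; _∸_; _≤_; _≥_; _<_; z≤n; s≤s; _≤ᵇ_; _!; NonZero)
  open import Data.Nat.Properties
  open import Data.Nat.ListAction using (product)
  open import Data.Nat.ListAction.Properties using (product-++; product-↭; product≢0)
  open import Data.Bool using (true; false)
  open import Data.Nat.Tactic.RingSolver using (solve-∀)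
  open import Algebra.Properties.CommutativeSemigroup *-commutativeSemigroup using () renaming (interchange to *-interchange)
  open import Relation.Nullary using (contradiction)

  ∏ : {A : Set} → (A → ℕ) → List A → ℕ
  ∏ f xs = product (map f xs)

  ∏pairs : {A : Set} → (A → A → ℕ) → List A → ℕ
  ∏pairs f []       = 1
  ∏pairs f (x ∷ xs) = ∏ (f x) xs * ∏pairs f xs

  module _ {A : Set} where

    ∏-++ : (f : A → ℕ) (xs ys : List A) → ∏ f (xs ++ ys) ≡ ∏ f xs * ∏ f ys
    ∏-++ f xs ys = trans (cong product (map-++ f xs ys)) (product-++ (map f xs) (map f ys))

    ∏-map : {B : Set} (f : A → ℕ) (g : B → A) (xs : List B) → ∏ f (map g xs) ≡ ∏ (f ∘ g) xs
    ∏-map f g xs = cong product (sym (map-∘ xs))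

    ∏-cong : {f g : A → ℕ} → (∀ x → f x ≡ g x) → (xs : List A) → ∏ f xs ≡ ∏ g xs
    ∏-cong f≗g xs = cong product (map-cong f≗g xs)

    ∏-cong-local : {f g : A → ℕ} {xs : List A} → All (λ x → f x ≡ g x) xs → ∏ f xs ≡ ∏ g xs
    ∏-cong-local eqs = cong product (map-cong-local eqs)

    ∏-reverse : (f : A → ℕ) (xs : List A) → ∏ f (reverse xs) ≡ ∏ f xs
    ∏-reverse f xs = product-↭ (Perm.map⁺ f (↭-reverse xs))

    ∏-nonZero : (f : A → ℕ) → (∀ x → NonZero (f x)) → (xs : List A) → NonZero (∏ f xs)
    ∏-nonZero f nz xs = product≢0 (All.map⁺ (All.universal nz xs))

    AllPairs-reverse : ∀ {R : A → A → Set} {xs} → AllPairs R xs → AllPairs (flip R) (reverse xs)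
    AllPairs-reverse []                        = []
    AllPairs-reverse {R} {x ∷ xs} (Rx ∷ Rxs) =
      subst (AllPairs (flip R)) (sym (unfold-reverse x xs))
        (AllPairs.++⁺ (AllPairs-reverse Rxs) ([] ∷ []) (All.map (_∷ []) (All-resp-↭ (↭-sym (↭-reverse xs)) Rx)))

    ∏pairs-∷ʳ : ∀ (f : A → A → ℕ) xs y → ∏pairs f (xs ∷ʳ y) ≡ ∏pairs f xs * ∏ (flip f y) xs
    ∏pairs-∷ʳ f []       y = refl
    ∏pairs-∷ʳ f (x ∷ xs) y = begin
      ∏ (f x) (xs ∷ʳ y) * ∏pairs f (xs ∷ʳ y)
        ≡⟨ cong₂ _*_ (trans (∏-++ (f x) xs (y ∷ [])) (cong (∏ (f x) xs *_) (*-identityʳ (f x y)))) (∏pairs-∷ʳ f xs y) ⟩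
      ∏ (f x) xs * f x y * (∏pairs f xs * ∏ (flip f y) xs)
        ≡⟨ *-interchange (∏ (f x) xs) (f x y) _ _ ⟩
      ∏ (f x) xs * ∏pairs f xs * (f x y * ∏ (flip f y) xs) ∎
      where open ≡-Reasoning

    ∏pairs-reverse : ∀ (f : A → A → ℕ) xs → ∏pairs f (reverse xs) ≡ ∏pairs (flip f) xs
    ∏pairs-reverse f []       = refl
    ∏pairs-reverse f (x ∷ xs) = begin
      ∏pairs f (reverse (x ∷ xs))                          ≡⟨ cong (∏pairs f) (unfold-reverse x xs) ⟩
      ∏pairs f (reverse xs ∷ʳ x)                           ≡⟨ ∏pairs-∷ʳ f (reverse xs) x ⟩
      ∏pairs f (reverse xs) * ∏ (flip f x) (reverse xs)    ≡⟨ cong₂ _*_ (∏pairs-reverse f xs) (∏-reverse (flip f x) xs) ⟩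
      ∏pairs (flip f) xs * ∏ (flip f x) xs                 ≡⟨ *-comm (∏pairs (flip f) xs) _ ⟩
      ∏pairs (flip f) (x ∷ xs)                             ∎
      where open ≡-Reasoning

    ∏pairs-map : ∀ {B : Set} (f : A → A → ℕ) (g : B → A) xs → ∏pairs f (map g xs) ≡ ∏pairs (λ a b → f (g a) (g b)) xs
    ∏pairs-map f g []       = refl
    ∏pairs-map f g (x ∷ xs) = cong₂ _*_ (∏-map (f (g x)) g xs) (∏pairs-map f g xs)

    ∏pairs-cong-local : ∀ {P : A → Set} {f g : A → A → ℕ} {xs} → All P xs →
      (∀ {a b} → P a → P b → f a b ≡ g a b) → ∏pairs f xs ≡ ∏pairs g xs
    ∏pairs-cong-local []         f≗g = refl
    ∏pairs-cong-local (px ∷ pxs) f≗g = cong₂ _*_ (∏-cong-local (All.map (f≗g px) pxs)) (∏pairs-cong-local pxs f≗g)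

  !-nonZero : ∀ n → NonZero (n !)
  !-nonZero n = ℕ.>-nonZero (1≤n! n)

  [m+o]∸[n+o]≡m∸n : ∀ m n o → (m + o) ∸ (n + o) ≡ m ∸ n
  [m+o]∸[n+o]≡m∸n m n o = trans (cong₂ _∸_ (+-comm m o) (+-comm n o)) ([m+n]∸[m+o]≡n∸o o m n)

  ∸-reflect : ∀ n a b → a < n → (n ∸ suc b) ∸ (n ∸ suc a) ≡ a ∸ b
  ∸-reflect n a b a<n with n ∸ suc a | m+[n∸m]≡n a<n
  ... | t | refl = trans (∸-+-assoc (a + t) b t) ([m+o]∸[n+o]≡m∸n a b t)

  range1≡applyUpTo : ∀ n → range1 n ≡ applyUpTo suc n
  range1≡applyUpTo zero    = refl
  range1≡applyUpTo (suc n) = trans (cong (_∷ʳ suc n) (range1≡applyUpTo n)) (applyUpTo-∷ʳ suc n)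

  range1-suc : ∀ n → range1 (suc n) ≡ 1 ∷ map suc (range1 n)
  range1-suc n = begin
    range1 (suc n)                 ≡⟨ range1≡applyUpTo (suc n) ⟩
    1 ∷ applyUpTo (suc ∘ suc) n    ≡⟨ cong (1 ∷_) (map-applyUpTo suc suc n) ⟨
    1 ∷ map suc (applyUpTo suc n)  ≡⟨ cong (λ r → 1 ∷ map suc r) (range1≡applyUpTo n) ⟨
    1 ∷ map suc (range1 n)         ∎
    where open ≡-Reasoning

  length-range1 : ∀ n → length (range1 n) ≡ n
  length-range1 n = trans (cong length (range1≡applyUpTo n)) (length-applyUpTo suc n)

  range1-bounds : ∀ n → All (λ j → 1 ≤ j × j ≤ n) (range1 n)
  range1-bounds n = subst (All _) (sym (range1≡applyUpTo n)) (All.applyUpTo⁺₁ suc n (λ j<n → s≤s z≤n , j<n))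

  range1-+ : ∀ m n → range1 (m + n) ≡ range1 m ++ map (m +_) (range1 n)
  range1-+ m zero    = trans (cong range1 (+-identityʳ m)) (sym (++-identityʳ (range1 m)))
  range1-+ m (suc n) = begin
    range1 (m + suc n)                                       ≡⟨ cong range1 (+-suc m n) ⟩
    range1 (m + n) ∷ʳ suc (m + n)                            ≡⟨ cong (_∷ʳ suc (m + n)) (range1-+ m n) ⟩
    (range1 m ++ map (m +_) (range1 n)) ∷ʳ suc (m + n)       ≡⟨ ++-assoc (range1 m) _ _ ⟩
    range1 m ++ (map (m +_) (range1 n) ∷ʳ suc (m + n))       ≡⟨ cong (λ k → range1 m ++ (map (m +_) (range1 n) ∷ʳ k)) (sym (+-suc m n)) ⟩
    range1 m ++ (map (m +_) (range1 n) ∷ʳ (m + suc n))       ≡⟨ cong (range1 m ++_) (sym (map-++ (m +_) (range1 n) _)) ⟩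
    range1 m ++ map (m +_) (range1 (suc n))                  ∎
    where open ≡-Reasoning

  ∏-falling : ∀ m n → ∏ (λ k → m + suc (n ∸ k)) (range1 n) * m ! ≡ (m + n) !
  ∏-falling m zero    = trans (*-identityˡ (m !)) (cong _! (sym (+-identityʳ m)))
  ∏-falling m (suc n) = begin
    ∏ (λ k → m + suc (suc n ∸ k)) (range1 (suc n)) * m !
      ≡⟨ cong (λ r → ∏ (λ k → m + suc (suc n ∸ k)) r * m !) (range1-suc n) ⟩
    (m + suc n) * ∏ (λ k → m + suc (suc n ∸ k)) (map suc (range1 n)) * m !
      ≡⟨ cong (λ r → (m + suc n) * r * m !) (∏-map _ suc (range1 n)) ⟩
    (m + suc n) * ∏ (λ k → m + suc (n ∸ k)) (range1 n) * m !
      ≡⟨ *-assoc (m + suc n) _ (m !) ⟩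
    (m + suc n) * (∏ (λ k → m + suc (n ∸ k)) (range1 n) * m !)
      ≡⟨ cong₂ _*_ (+-suc m n) (∏-falling m n) ⟩
    suc (m + n) !
      ≡⟨ cong _! (sym (+-suc m n)) ⟩
    (m + suc n) ! ∎
    where open ≡-Reasoning

  ∏-falling-∸ : ∀ {q x} → x ≤ q → ∏ (suc q ∸_) (range1 x) * (q ∸ x) ! ≡ q !
  ∏-falling-∸ {q} {x} x≤q = begin
    ∏ (suc q ∸_) (range1 x) * (q ∸ x) !
      ≡⟨ cong (_* (q ∸ x) !) (∏-cong-local (All.map (splitAt ∘ proj₂) (range1-bounds x))) ⟩
    ∏ (λ k → (q ∸ x) + suc (x ∸ k)) (range1 x) * (q ∸ x) !
      ≡⟨ ∏-falling (q ∸ x) x ⟩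
    ((q ∸ x) + x) !
      ≡⟨ cong _! (m∸n+n≡m x≤q) ⟩
    q ! ∎
    where
    open ≡-Reasoning
    splitAt : ∀ {k} → k ≤ x → suc q ∸ k ≡ (q ∸ x) + suc (x ∸ k)
    splitAt {k} k≤x = begin
      suc q ∸ k                  ≡⟨ +-∸-assoc 1 (≤-trans k≤x x≤q) ⟩
      suc (q ∸ k)                ≡⟨ cong (λ n → suc (n ∸ k)) (m∸n+n≡m x≤q) ⟨
      suc ((q ∸ x) + x ∸ k)      ≡⟨ cong suc (+-∸-assoc (q ∸ x) k≤x) ⟩
      suc ((q ∸ x) + (x ∸ k))    ≡⟨ +-suc (q ∸ x) (x ∸ k) ⟨
      (q ∸ x) + suc (x ∸ k)      ∎

  ∏-rising : ∀ m n → ∏ (m +_) (range1 n) * m ! ≡ (n + m) !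
  ∏-rising m zero    = *-identityˡ (m !)
  ∏-rising m (suc n) = begin
    ∏ (m +_) (range1 n ∷ʳ suc n) * m !             ≡⟨ cong (_* m !) (∏-++ (m +_) (range1 n) (suc n ∷ [])) ⟩
    ∏ (m +_) (range1 n) * ((m + suc n) * 1) * m !  ≡⟨ regroup (∏ (m +_) (range1 n)) (m + suc n) (m !) ⟩
    (m + suc n) * (∏ (m +_) (range1 n) * m !)      ≡⟨ cong₂ _*_ (trans (+-suc m n) (cong suc (+-comm m n))) (∏-rising m n) ⟩
    suc (n + m) * (n + m) !                        ∎
    where
    open ≡-Reasoning
    regroup : ∀ a b c → a * (b * 1) * c ≡ b * (a * c)
    regroup = solve-∀

  squares-∷ : ∀ x μ → squares (x ∷ μ) ≡ map (1 ,_) (range1 x) ++ map (map₁ suc) (squares μ)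
  squares-∷ x μ = begin
    concat (map row (range1 (suc (length μ))))
      ≡⟨ cong (concat ∘ map row) (range1-suc (length μ)) ⟩
    map (1 ,_) (range1 x) ++ concat (map row (map suc (range1 (length μ))))
      ≡⟨ cong (λ rs → map (1 ,_) (range1 x) ++ concat rs) (sym (map-∘ (range1 (length μ)))) ⟩
    map (1 ,_) (range1 x) ++ concat (map (row ∘ suc) (range1 (length μ)))
      ≡⟨ cong (λ rs → map (1 ,_) (range1 x) ++ concat rs) (map-cong-local (All.map shiftRow (range1-bounds (length μ)))) ⟩
    map (1 ,_) (range1 x) ++ concat (map (map (map₁ suc) ∘ rowμ) (range1 (length μ)))
      ≡⟨ cong (λ rs → map (1 ,_) (range1 x) ++ concat rs) (map-∘ (range1 (length μ))) ⟩
    map (1 ,_) (range1 x) ++ concat (map (map (map₁ suc)) (map rowμ (range1 (length μ))))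
      ≡⟨ cong (map (1 ,_) (range1 x) ++_) (concat-map (map rowμ (range1 (length μ)))) ⟩
    map (1 ,_) (range1 x) ++ map (map₁ suc) (squares μ) ∎
    where
    open ≡-Reasoning
    row rowμ : ℕ → List (ℕ × ℕ)
    row  i = map (i ,_) (range1 (part (x ∷ μ) i))
    rowμ i = map (i ,_) (range1 (part μ i))
    shiftRow : ∀ {i} → 1 ≤ i × i ≤ length μ → row (suc i) ≡ map (map₁ suc) (rowμ i)
    shiftRow (s≤s _ , _) = map-∘ _

  length-squares : ∀ λs → length (squares λs) ≡ size λs
  length-squares []       = refl
  length-squares (x ∷ μ) = begin
    length (squares (x ∷ μ))                ≡⟨ cong length (squares-∷ x μ) ⟩
    length (top ++ lower)                   ≡⟨ length-++ top {lower} ⟩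
    length top + length lower               ≡⟨ cong₂ _+_ (length-map {B = ℕ × ℕ} (1 ,_) (range1 x)) (length-map (map₁ suc) (squares μ)) ⟩
    length (range1 x) + length (squares μ)  ≡⟨ cong₂ _+_ (length-range1 x) (length-squares μ) ⟩
    x + size μ                              ∎
    where
    open ≡-Reasoning
    top lower : List (ℕ × ℕ)
    top   = map (1 ,_) (range1 x)
    lower = map (map₁ suc) (squares μ)

  IsSquare : List ℕ → ℕ × ℕ → Set
  IsSquare λs (i , j) = (1 ≤ i × i ≤ length λs) × (1 ≤ j × j ≤ part λs i)

  squares-IsSquare : ∀ λs → All (IsSquare λs) (squares λs)
  squares-IsSquare []      = []
  squares-IsSquare (x ∷ μ) rewrite squares-∷ x μ =
    All.++⁺ (All.map⁺ (All.map topRow (range1-bounds x))) (All.map⁺ (All.map lowerRow (squares-IsSquare μ)))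
    where
    topRow : ∀ {j} → 1 ≤ j × j ≤ x → IsSquare (x ∷ μ) (1 , j)
    topRow j-bounds = (≤-refl , s≤s z≤n) , j-bounds
    lowerRow : ∀ {u} → IsSquare μ u → IsSquare (x ∷ μ) (map₁ suc u)
    lowerRow {suc i , j} ((_ , i≤m) , j-bounds) = (s≤s z≤n , s≤s i≤m) , j-bounds

  part-≤ : ∀ {q} λs → All (_≤ q) λs → ∀ i → part λs i ≤ q
  part-≤ []       []          i             = z≤n
  part-≤ (x ∷ xs) _           zero          = z≤n
  part-≤ (x ∷ xs) (x≤q ∷ _)   (suc zero)    = x≤q
  part-≤ (x ∷ xs) (_ ∷ xs≤q)  (suc (suc i)) = part-≤ xs xs≤q (suc i)

  ∏-squares-∷ : ∀ (f : ℕ × ℕ → ℕ) x μ →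
    ∏ f (squares (x ∷ μ)) ≡ ∏ (λ j → f (1 , j)) (range1 x) * ∏ (f ∘ map₁ suc) (squares μ)
  ∏-squares-∷ f x μ = begin
    ∏ f (squares (x ∷ μ))                                         ≡⟨ cong (∏ f) (squares-∷ x μ) ⟩
    ∏ f (map (1 ,_) (range1 x) ++ map (map₁ suc) (squares μ))     ≡⟨ ∏-++ f (map (1 ,_) (range1 x)) _ ⟩
    ∏ f (map (1 ,_) (range1 x)) * ∏ f (map (map₁ suc) (squares μ)) ≡⟨ cong₂ _*_ (∏-map f _ (range1 x)) (∏-map f _ (squares μ)) ⟩
    ∏ (λ j → f (1 , j)) (range1 x) * ∏ (f ∘ map₁ suc) (squares μ) ∎
    where open ≡-Reasoning

  H≡∏hook : ∀ λs → H λs ≡ ∏ (hook λs) (squares λs)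
  H≡∏hook λs = sym (foldr-map _*_ (hook λs) 1 (squares λs))

  H-nonZero : ∀ λs → NonZero (H λs)
  H-nonZero λs = subst NonZero (sym (H≡∏hook λs)) (∏-nonZero (hook λs) (λ _ → _) (squares λs))

  count≥-∷-≥ : ∀ {j x} μ → j ≤ x → count≥ j (x ∷ μ) ≡ suc (count≥ j μ)
  count≥-∷-≥ {j} {x} μ j≤x with j ≤ᵇ x | ≤⇒≤ᵇ j≤x
  ... | true | _ = refl

  count≥-∷-< : ∀ {j x} μ → x < j → count≥ j (x ∷ μ) ≡ count≥ j μ
  count≥-∷-< {j} {x} μ x<j with j ≤ᵇ x | ≤ᵇ⇒≤ j x
  ... | false | _   = refl
  ... | true  | j≤x = contradiction (j≤x _) (<⇒≱ x<j)

  count≥-beyond : ∀ {j y} ν → All (_≤ y) ν → y < j → count≥ j ν ≡ 0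
  count≥-beyond []      []          _   = refl
  count≥-beyond (z ∷ ν) (z≤y ∷ ν≤y) y<j = trans (count≥-∷-< ν (≤-<-trans z≤y y<j)) (count≥-beyond ν ν≤y y<j)

  topRowHooks : ℕ → List ℕ → ℕ
  topRowHooks x μ = ∏ (λ j → suc ((x ∸ j) + count≥ j μ)) (range1 x)

  H-∷ : ∀ x μ → All (_≤ x) μ → H (x ∷ μ) ≡ topRowHooks x μ * H μ
  H-∷ x μ μ≤x = begin
    H (x ∷ μ)                                                                              ≡⟨ H≡∏hook (x ∷ μ) ⟩
    ∏ (hook (x ∷ μ)) (squares (x ∷ μ))                                                     ≡⟨ ∏-squares-∷ (hook (x ∷ μ)) x μ ⟩
    ∏ (λ j → hook (x ∷ μ) (1 , j)) (range1 x) * ∏ (hook (x ∷ μ) ∘ map₁ suc) (squares μ)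
      ≡⟨ cong₂ _*_ (∏-cong-local (All.map (topHook ∘ proj₂) (range1-bounds x)))
                   (∏-cong-local (All.map lowerHook (squares-IsSquare μ))) ⟩
    topRowHooks x μ * ∏ (hook μ) (squares μ)                                               ≡⟨ cong (topRowHooks x μ *_) (sym (H≡∏hook μ)) ⟩
    topRowHooks x μ * H μ                                                                  ∎
    where
    open ≡-Reasoning
    topHook : ∀ {j} → j ≤ x → hook (x ∷ μ) (1 , j) ≡ suc ((x ∸ j) + count≥ j μ)
    topHook {j} j≤x = cong (λ c → suc ((x ∸ j) + (c ∸ 1))) (count≥-∷-≥ μ j≤x)
    lowerHook : ∀ {u} → IsSquare μ u → hook (x ∷ μ) (map₁ suc u) ≡ hook μ u
    lowerHook {suc i , j} (_ , (_ , j≤λᵢ)) =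
      cong (λ c → suc ((part μ (suc i) ∸ j) + (c ∸ suc (suc i)))) (count≥-∷-≥ μ (≤-trans j≤λᵢ (part-≤ μ μ≤x (suc i))))

  topRowHooks-split : ∀ y d ν → All (_≤ y) ν →
    topRowHooks (y + d) ν ≡ ∏ (λ j → suc ((y + d ∸ j) + count≥ j ν)) (range1 y) * d !
  topRowHooks-split y d ν ν≤y = begin
    ∏ f (range1 (y + d))                                ≡⟨ cong (∏ f) (range1-+ y d) ⟩
    ∏ f (range1 y ++ map (y +_) (range1 d))             ≡⟨ ∏-++ f (range1 y) _ ⟩
    ∏ f (range1 y) * ∏ f (map (y +_) (range1 d))        ≡⟨ cong (∏ f (range1 y) *_) (∏-map f (y +_) (range1 d)) ⟩
    ∏ f (range1 y) * ∏ (f ∘ (y +_)) (range1 d)          ≡⟨ cong (∏ f (range1 y) *_) (∏-cong-local beyond) ⟩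
    ∏ f (range1 y) * ∏ (λ k → suc (d ∸ k)) (range1 d)   ≡⟨ cong (∏ f (range1 y) *_) (trans (sym (*-identityʳ _)) (∏-falling 0 d)) ⟩
    ∏ f (range1 y) * d !                                ∎
    where
    open ≡-Reasoning
    f : ℕ → ℕ
    f j = suc ((y + d ∸ j) + count≥ j ν)
    beyondRow : ∀ {k} → 1 ≤ k → f (y + k) ≡ suc (d ∸ k)
    beyondRow {k} 1≤k =
      cong suc (trans (cong₂ _+_ ([m+n]∸[m+o]≡n∸o y d k) (count≥-beyond ν ν≤y (m<m+n y 1≤k))) (+-identityʳ (d ∸ k)))
    beyond : All (λ k → f (y + k) ≡ suc (d ∸ k)) (range1 d)
    beyond = All.map (beyondRow ∘ proj₁) (range1-bounds d)

  topRowHooks-∷ : ∀ {x y} ν → y ≤ x → All (_≤ y) ν → topRowHooks x (y ∷ ν) * suc (x ∸ y) ≡ topRowHooks (suc x) ν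
  topRowHooks-∷ {x} {y} ν y≤x ν≤y with x ∸ y | m+[n∸m]≡n y≤x
  ... | d | refl = begin
    topRowHooks (y + d) (y ∷ ν) * suc d    ≡⟨ cong (_* suc d) (topRowHooks-split y d (y ∷ ν) (≤-refl ∷ ν≤y)) ⟩
    ∏ f (range1 y) * d ! * suc d           ≡⟨ cong (λ a → a * d ! * suc d) (∏-cong-local (All.map (extraLeg ∘ proj₂) (range1-bounds y))) ⟩
    ∏ g (range1 y) * d ! * suc d           ≡⟨ *-assoc (∏ g (range1 y)) (d !) (suc d) ⟩
    ∏ g (range1 y) * (d ! * suc d)         ≡⟨ cong (∏ g (range1 y) *_) (*-comm (d !) (suc d)) ⟩
    ∏ g (range1 y) * suc d !               ≡⟨ topRowHooks-split y (suc d) ν ν≤y ⟨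
    topRowHooks (y + suc d) ν              ≡⟨ cong (λ n → topRowHooks n ν) (+-suc y d) ⟩
    topRowHooks (suc (y + d)) ν            ∎
    where
    open ≡-Reasoning
    f g : ℕ → ℕ
    f j = suc ((y + d ∸ j) + count≥ j (y ∷ ν))
    g j = suc ((y + suc d ∸ j) + count≥ j ν)
    extraLeg : ∀ {j} → j ≤ y → f j ≡ g j
    extraLeg {j} j≤y = cong suc (begin
      (y + d ∸ j) + count≥ j (y ∷ ν)     ≡⟨ cong ((y + d ∸ j) +_) (count≥-∷-≥ ν j≤y) ⟩
      (y + d ∸ j) + suc (count≥ j ν)     ≡⟨ +-suc (y + d ∸ j) _ ⟩
      suc (y + d ∸ j) + count≥ j ν       ≡⟨ cong (_+ count≥ j ν) (+-∸-assoc 1 (≤-trans j≤y (m≤m+n y d))) ⟨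
      (suc (y + d) ∸ j) + count≥ j ν     ≡⟨ cong (λ n → (n ∸ j) + count≥ j ν) (+-suc y d) ⟨
      (y + suc d ∸ j) + count≥ j ν       ∎)

  shifted : List ℕ → List ℕ
  shifted []       = []
  shifted (x ∷ xs) = x + length xs ∷ shifted xs

  topRowHooks-differences : ∀ x μ → AllPairs _≥_ μ → All (_≤ x) μ →
    topRowHooks x μ * ∏ (x + length μ ∸_) (shifted μ) ≡ (x + length μ) !
  topRowHooks-differences x [] [] [] = begin
    topRowHooks x [] * 1  ≡⟨ *-identityʳ _ ⟩
    topRowHooks x []      ≡⟨ topRowHooks-split 0 x [] [] ⟩
    1 * x !               ≡⟨ *-identityˡ _ ⟩
    x !                   ≡⟨ cong _! (+-identityʳ x) ⟨
    (x + 0) !             ∎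
    where open ≡-Reasoning
  topRowHooks-differences x (y ∷ ν) (ν≤y ∷ ν-dec) (y≤x ∷ ν≤x) = begin
    topRowHooks x (y ∷ ν) * ((x + suc n ∸ (y + n)) * ∏ (x + suc n ∸_) (shifted ν))
      ≡⟨ cong (topRowHooks x (y ∷ ν) *_) (cong₂ _*_ gap (∏-cong (λ l → cong (_∸ l) (+-suc x n)) (shifted ν))) ⟩
    topRowHooks x (y ∷ ν) * (suc (x ∸ y) * ∏ (suc x + n ∸_) (shifted ν))
      ≡⟨ *-assoc (topRowHooks x (y ∷ ν)) _ _ ⟨
    topRowHooks x (y ∷ ν) * suc (x ∸ y) * ∏ (suc x + n ∸_) (shifted ν)
      ≡⟨ cong (_* ∏ (suc x + n ∸_) (shifted ν)) (topRowHooks-∷ ν y≤x ν≤y) ⟩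
    topRowHooks (suc x) ν * ∏ (suc x + n ∸_) (shifted ν)
      ≡⟨ topRowHooks-differences (suc x) ν ν-dec (All.map m≤n⇒m≤1+n ν≤x) ⟩
    (suc x + n) !
      ≡⟨ cong _! (+-suc x n) ⟨
    (x + suc n) ! ∎
    where
    open ≡-Reasoning
    n = length ν
    gap : x + suc n ∸ (y + n) ≡ suc (x ∸ y)
    gap = trans (cong (_∸ (y + n)) (+-suc x n)) (trans ([m+o]∸[n+o]≡m∸n (suc x) y n) (+-∸-assoc 1 y≤x))

  vandermonde : List ℕ → ℕ
  vandermonde = ∏pairs _∸_

  H-*-vandermonde : ∀ λs → AllPairs _≥_ λs → H λs * vandermonde (shifted λs) ≡ ∏ _! (shifted λs)
  H-*-vandermonde []      []              = refl
  H-*-vandermonde (x ∷ μ) (μ≤x ∷ μ-dec) = begin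
    H (x ∷ μ) * (∏ (x + m ∸_) (shifted μ) * vandermonde (shifted μ))
      ≡⟨ cong (_* vandermonde (shifted (x ∷ μ))) (H-∷ x μ μ≤x) ⟩
    topRowHooks x μ * H μ * (∏ (x + m ∸_) (shifted μ) * vandermonde (shifted μ))
      ≡⟨ *-interchange (topRowHooks x μ) (H μ) _ _ ⟩
    topRowHooks x μ * ∏ (x + m ∸_) (shifted μ) * (H μ * vandermonde (shifted μ))
      ≡⟨ cong₂ _*_ (topRowHooks-differences x μ μ-dec μ≤x) (H-*-vandermonde μ μ-dec) ⟩
    (x + m) ! * ∏ _! (shifted μ) ∎
    where
    open ≡-Reasoning
    m = length μ

  replicate-decreasing : ∀ p q → AllPairs _≥_ (replicate p q)
  replicate-decreasing zero    q = []
  replicate-decreasing (suc p) q = All.replicate⁺ p ≤-refl ∷ replicate-decreasing p q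

  shifted-replicate : ∀ p q → shifted (replicate p q) ≡ map (q +_) (downFrom p)
  shifted-replicate zero    q = refl
  shifted-replicate (suc p) q = cong₂ _∷_ (cong (q +_) (length-replicate p)) (shifted-replicate p q)

  vandermonde-+ : ∀ q xs → vandermonde (map (q +_) xs) ≡ vandermonde xs
  vandermonde-+ q []       = refl
  vandermonde-+ q (a ∷ xs) = cong₂ _*_ (trans (∏-map _ (q +_) xs) (∏-cong ([m+n]∸[m+o]≡n∸o q a) xs)) (vandermonde-+ q xs)

  H-zeros : ∀ p → H (replicate p 0) ≡ 1
  H-zeros zero    = refl
  H-zeros (suc p) = trans (H-∷ 0 (replicate p 0) (All.replicate⁺ p z≤n)) (trans (*-identityˡ _) (H-zeros p))

  vandermonde-downFrom : ∀ p → vandermonde (downFrom p) ≡ ∏ _! (downFrom p)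
  vandermonde-downFrom p = begin
    vandermonde (downFrom p)                              ≡⟨ cong vandermonde zeros-shifted ⟨
    vandermonde (shifted (replicate p 0))                 ≡⟨ trans (cong (_* vandermonde (shifted (replicate p 0))) (H-zeros p)) (*-identityˡ _) ⟨
    H (replicate p 0) * vandermonde (shifted (replicate p 0)) ≡⟨ H-*-vandermonde (replicate p 0) (replicate-decreasing p 0) ⟩
    ∏ _! (shifted (replicate p 0))                        ≡⟨ cong (∏ _!) zeros-shifted ⟩
    ∏ _! (downFrom p)                                     ∎
    where
    open ≡-Reasoning
    zeros-shifted : shifted (replicate p 0) ≡ downFrom p
    zeros-shifted = trans (shifted-replicate p 0) (map-id (downFrom p))

  H-rectangle : ∀ p q → H (rect p q) * ∏ _! (downFrom p) ≡ ∏ (λ k → (q + k) !) (upTo p)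
  H-rectangle p q = begin
    H (rect p q) * ∏ _! (downFrom p)                        ≡⟨ cong (H (rect p q) *_) (vandermonde-downFrom p) ⟨
    H (rect p q) * vandermonde (downFrom p)                 ≡⟨ cong (H (rect p q) *_) (vandermonde-+ q (downFrom p)) ⟨
    H (rect p q) * vandermonde (map (q +_) (downFrom p))    ≡⟨ cong (λ xs → H (rect p q) * vandermonde xs) (shifted-replicate p q) ⟨
    H (rect p q) * vandermonde (shifted (rect p q))         ≡⟨ H-*-vandermonde (rect p q) (replicate-decreasing p q) ⟩
    ∏ _! (shifted (rect p q))                               ≡⟨ cong (∏ _!) (shifted-replicate p q) ⟩
    ∏ _! (map (q +_) (downFrom p))                          ≡⟨ ∏-map _! (q +_) (downFrom p) ⟩
    ∏ (λ k → (q + k) !) (downFrom p)                        ≡⟨ cong (∏ (λ k → (q + k) !)) (reverse-upTo p) ⟨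
    ∏ (λ k → (q + k) !) (reverse (upTo p))                  ≡⟨ ∏-reverse (λ k → (q + k) !) (upTo p) ⟩
    ∏ (λ k → (q + k) !) (upTo p)                            ∎
    where open ≡-Reasoning

  complement-∷ : ∀ q x xs → complement q (x ∷ xs) ≡ complement q xs ∷ʳ (q ∸ x)
  complement-∷ q x xs = trans (cong (map (q ∸_)) (unfold-reverse x xs)) (map-++ (q ∸_) (reverse xs) (x ∷ []))

  complement-decreasing : ∀ q {λs} → AllPairs _≥_ λs → AllPairs _≥_ (complement q λs)
  complement-decreasing q λs-dec = AllPairs.map⁺ (AllPairs.map (∸-monoʳ-≤ q) (AllPairs-reverse λs-dec))

  shifted-∷ʳ : ∀ xs y → shifted (xs ∷ʳ y) ≡ map suc (shifted xs) ∷ʳ y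
  shifted-∷ʳ []       y = cong (_∷ []) (+-identityʳ y)
  shifted-∷ʳ (x ∷ xs) y = cong₂ _∷_ (trans (cong (x +_) (trans (length-++ xs) (+-comm (length xs) 1))) (+-suc x (length xs))) (shifted-∷ʳ xs y)

  shifted-bounded : ∀ {q} λs → All (_≤ q) λs → All (_< q + length λs) (shifted λs)
  shifted-bounded []       []          = []
  shifted-bounded (x ∷ xs) (x≤q ∷ xs≤q) =
    subst (x + length xs <_) (sym (+-suc _ (length xs))) (s≤s (+-monoˡ-≤ (length xs) x≤q))
    ∷ All.map (λ l< → <-≤-trans l< (+-monoʳ-≤ _ (n≤1+n (length xs)))) (shifted-bounded xs xs≤q)

  shifted-complement : ∀ q λs → All (_≤ q) λs →
    shifted (complement q λs) ≡ reverse (map (λ l → q + length λs ∸ suc l) (shifted λs))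
  shifted-complement q []       []          = refl
  shifted-complement q (x ∷ xs) (x≤q ∷ xs≤q) = begin
    shifted (complement q (x ∷ xs))                              ≡⟨ cong shifted (complement-∷ q x xs) ⟩
    shifted (complement q xs ∷ʳ (q ∸ x))                         ≡⟨ shifted-∷ʳ (complement q xs) (q ∸ x) ⟩
    map suc (shifted (complement q xs)) ∷ʳ (q ∸ x)               ≡⟨ cong (λ ls → map suc ls ∷ʳ (q ∸ x)) (shifted-complement q xs xs≤q) ⟩
    map suc (reverse (map g′ (shifted xs))) ∷ʳ (q ∸ x)           ≡⟨ cong (_∷ʳ (q ∸ x)) (reverse-map suc (map g′ (shifted xs))) ⟩
    reverse (map suc (map g′ (shifted xs))) ∷ʳ (q ∸ x)           ≡⟨ cong₂ (λ ls l → reverse ls ∷ʳ l) lower top ⟩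
    reverse (map g (shifted xs)) ∷ʳ g (x + m)                    ≡⟨ unfold-reverse (g (x + m)) (map g (shifted xs)) ⟨
    reverse (map g (shifted (x ∷ xs)))                           ∎
    where
    open ≡-Reasoning
    m = length xs
    g′ g : ℕ → ℕ
    g′ l = q + m ∸ suc l
    g  l = q + suc m ∸ suc l
    top : q ∸ x ≡ g (x + m)
    top = sym (trans (cong (_∸ suc (x + m)) (+-suc q m)) ([m+o]∸[n+o]≡m∸n q x m))
    lower : map suc (map g′ (shifted xs)) ≡ map g (shifted xs)
    lower = trans (sym (map-∘ (shifted xs)))
      (map-cong-local (All.map (λ {l} l< → trans (sym (+-∸-assoc 1 l<)) (cong (_∸ suc l) (sym (+-suc q m)))) (shifted-bounded xs xs≤q)))

  vandermonde-complement : ∀ q λs → All (_≤ q) λs → vandermonde (shifted (complement q λs)) ≡ vandermonde (shifted λs)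
  vandermonde-complement q λs λs≤q = begin
    vandermonde (shifted (complement q λs))                 ≡⟨ cong vandermonde (shifted-complement q λs λs≤q) ⟩
    ∏pairs _∸_ (reverse (map g (shifted λs)))               ≡⟨ ∏pairs-reverse _∸_ (map g (shifted λs)) ⟩
    ∏pairs (flip _∸_) (map g (shifted λs))                  ≡⟨ ∏pairs-map (flip _∸_) g (shifted λs) ⟩
    ∏pairs (λ a b → g b ∸ g a) (shifted λs)                 ≡⟨ ∏pairs-cong-local (shifted-bounded λs λs≤q) (λ a< _ → ∸-reflect _ _ _ a<) ⟩
    vandermonde (shifted λs)                                ∎
    where
    open ≡-Reasoning
    g : ℕ → ℕ
    g l = q + length λs ∸ suc l

  H-complement : ∀ q λs → AllPairs _≥_ λs → All (_≤ q) λs →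
    H (complement q λs) * vandermonde (shifted λs) ≡ ∏ (λ l → (q + length λs ∸ suc l) !) (shifted λs)
  H-complement q λs λs-dec λs≤q = begin
    H (complement q λs) * vandermonde (shifted λs)                   ≡⟨ cong (H (complement q λs) *_) (vandermonde-complement q λs λs≤q) ⟨
    H (complement q λs) * vandermonde (shifted (complement q λs))    ≡⟨ H-*-vandermonde (complement q λs) (complement-decreasing q λs-dec) ⟩
    ∏ _! (shifted (complement q λs))                                 ≡⟨ cong (∏ _!) (shifted-complement q λs λs≤q) ⟩
    ∏ _! (reverse (map g (shifted λs)))                              ≡⟨ ∏-reverse _! (map g (shifted λs)) ⟩
    ∏ _! (map g (shifted λs))                                        ≡⟨ ∏-map _! g (shifted λs) ⟩
    ∏ (λ l → g l !) (shifted λs)                                     ∎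
    where
    open ≡-Reasoning
    g : ℕ → ℕ
    g l = q + length λs ∸ suc l

  -- p + c(u) and q − c(u) for u = (i , j); the truncated subtractions are exact on the squares of λ ⊆ p × q.
  plusContent minusContent : ℕ → ℕ × ℕ → ℕ
  plusContent  p (i , j) = (p ∸ i) + j
  minusContent q (i , j) = (i + q) ∸ j

  ∏plusContent : ∀ λs → ∏ (plusContent (length λs)) (squares λs) * ∏ _! (downFrom (length λs)) ≡ ∏ _! (shifted λs)
  ∏plusContent []      = refl
  ∏plusContent (x ∷ μ) = begin
    ∏ (plusContent (suc m)) (squares (x ∷ μ)) * (m ! * ∏ _! (downFrom m))
      ≡⟨ cong (_* (m ! * ∏ _! (downFrom m))) (∏-squares-∷ (plusContent (suc m)) x μ) ⟩
    ∏ (m +_) (range1 x) * ∏ (plusContent m) (squares μ) * (m ! * ∏ _! (downFrom m))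
      ≡⟨ *-interchange (∏ (m +_) (range1 x)) _ _ _ ⟩
    ∏ (m +_) (range1 x) * m ! * (∏ (plusContent m) (squares μ) * ∏ _! (downFrom m))
      ≡⟨ cong₂ _*_ (∏-rising m x) (∏plusContent μ) ⟩
    (x + m) ! * ∏ _! (shifted μ) ∎
    where
    open ≡-Reasoning
    m = length μ

  ∏minusContent : ∀ q λs → All (_≤ q) λs →
    ∏ (minusContent q) (squares λs) * ∏ (λ l → (q + length λs ∸ suc l) !) (shifted λs) ≡ ∏ (λ k → (q + k) !) (upTo (length λs))
  ∏minusContent q []      []          = refl
  ∏minusContent q (x ∷ μ) (x≤q ∷ μ≤q) = begin
    ∏ (minusContent q) (squares (x ∷ μ)) * ((q + suc m ∸ suc (x + m)) ! * ∏ (λ l → (q + suc m ∸ suc l) !) (shifted μ))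
      ≡⟨ cong₂ _*_ (trans (∏-squares-∷ (minusContent q) x μ) (cong (∏ (suc q ∸_) (range1 x) *_) lowerRows))
                   (cong₂ _*_ (cong _! corner) (∏-cong (λ l → cong (λ n → (n ∸ suc l) !) (+-suc q m)) (shifted μ))) ⟩
    ∏ (suc q ∸_) (range1 x) * ∏ (minusContent (suc q)) (squares μ) * ((q ∸ x) ! * ∏ (λ l → (suc q + m ∸ suc l) !) (shifted μ))
      ≡⟨ *-interchange (∏ (suc q ∸_) (range1 x)) _ _ _ ⟩
    ∏ (suc q ∸_) (range1 x) * (q ∸ x) ! * (∏ (minusContent (suc q)) (squares μ) * ∏ (λ l → (suc q + m ∸ suc l) !) (shifted μ))
      ≡⟨ cong₂ _*_ (∏-falling-∸ x≤q) (∏minusContent (suc q) μ (All.map m≤n⇒m≤1+n μ≤q)) ⟩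
    q ! * ∏ (λ k → (suc q + k) !) (upTo m)
      ≡⟨ cong (q ! *_) (∏-cong (λ k → cong _! (+-suc q k)) (upTo m)) ⟨
    q ! * ∏ (λ k → (q + suc k) !) (upTo m)
      ≡⟨ cong₂ (λ a b → a ! * b) (+-identityʳ q) (trans (cong (∏ (λ k → (q + k) !)) (sym (map-upTo suc m))) (∏-map _ suc (upTo m))) ⟨
    ∏ (λ k → (q + k) !) (upTo (suc m)) ∎
    where
    open ≡-Reasoning
    m = length μ
    corner : q + suc m ∸ suc (x + m) ≡ q ∸ x
    corner = trans (cong (_∸ suc (x + m)) (+-suc q m)) ([m+o]∸[n+o]≡m∸n q x m)
    lowerRows : ∏ (minusContent q ∘ map₁ suc) (squares μ) ≡ ∏ (minusContent (suc q)) (squares μ)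
    lowerRows = ∏-cong (λ u → cong (_∸ proj₂ u) (sym (+-suc (proj₁ u) q))) (squares μ)

  H-rectangle-*-H : ∀ q λs → AllPairs _≥_ λs → All (_≤ q) λs →
    H (rect (length λs) q) * H λs ≡ H (complement q λs) * ∏ (plusContent (length λs)) (squares λs) * ∏ (minusContent q) (squares λs)
  H-rectangle-*-H q λs λs-dec λs≤q = *-cancelʳ-≡ (Hr * Hλ) (Hc * P * Q) (Δ * Z * F̃) {{C≢0}} (begin
    Hr * Hλ * (Δ * Z * F̃)          ≡⟨ regroupˡ Hr Hλ Δ Z F̃ ⟩
    Hr * Z * (Hλ * Δ) * F̃          ≡⟨ cong₂ (λ a b → a * b * F̃) (H-rectangle p q) (H-*-vandermonde λs λs-dec) ⟩
    T * F * F̃                       ≡⟨ reverse₃ T F F̃ ⟩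
    F̃ * F * T                       ≡⟨ cong₂ _*_ (cong₂ _*_ Hc-Δ (∏plusContent λs)) (∏minusContent q λs λs≤q) ⟨
    Hc * Δ * (P * Z) * (Q * F̃)      ≡⟨ regroupʳ Hc Δ P Z Q F̃ ⟩
    Hc * P * Q * (Δ * Z * F̃)        ∎)
    where
    open ≡-Reasoning
    regroupˡ : ∀ a b c d e → a * b * (c * d * e) ≡ a * d * (b * c) * e
    regroupˡ = solve-∀
    reverse₃ : ∀ a b c → a * b * c ≡ c * b * a
    reverse₃ = solve-∀
    regroupʳ : ∀ a b c d e f → a * b * (c * d) * (e * f) ≡ a * c * e * (b * d * f)
    regroupʳ = solve-∀
    p = length λs
    Hr Hλ Hc P Q Δ Z F F̃ T : ℕ
    Hr = H (rect p q)
    Hλ = H λs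
    Hc = H (complement q λs)
    P  = ∏ (plusContent p) (squares λs)
    Q  = ∏ (minusContent q) (squares λs)
    Δ  = vandermonde (shifted λs)
    Z  = ∏ _! (downFrom p)
    F  = ∏ _! (shifted λs)
    F̃  = ∏ (λ l → (q + p ∸ suc l) !) (shifted λs)
    T  = ∏ (λ k → (q + k) !) (upTo p)
    Hc-Δ : Hc * Δ ≡ F̃
    Hc-Δ = H-complement q λs λs-dec λs≤q
    F≢0 : NonZero F
    F≢0 = ∏-nonZero _! !-nonZero (shifted λs)
    Δ≢0 : NonZero Δ
    Δ≢0 = m*n≢0⇒n≢0 Hλ {{subst NonZero (sym (H-*-vandermonde λs λs-dec)) F≢0}}
    Z≢0 : NonZero Z
    Z≢0 = ∏-nonZero _! !-nonZero (downFrom p)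
    F̃≢0 : NonZero F̃
    F̃≢0 = ∏-nonZero _ (λ l → !-nonZero (q + p ∸ suc l)) (shifted λs)
    C≢0 : NonZero (Δ * Z * F̃)
    C≢0 = m*n≢0 (Δ * Z) F̃ {{m*n≢0 Δ Z {{Δ≢0}} {{Z≢0}}}} {{F̃≢0}}

open HookLengthProducts
open import Data.Nat as ℕ using (ℕ; suc; _≤_; _≥_)
import Data.Nat.Properties as ℕₚ
open import Data.Integer as ℤ using (ℤ; +_; -_; _^_)
import Data.Integer.Properties as ℤₚ
open import Data.Integer.Tactic.RingSolver using (solve-∀)
open import Data.Rational as ℚ using (ℚ; _*_; _/_; 1ℚ)
import Data.Rational.Properties as ℚₚ
import Data.Rational.Unnormalised as ℚᵘ
import Data.Rational.Unnormalised.Properties as ℚᵘₚ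
open import Data.Rational.Solver using (module +-*-Solver)
open import Algebra.Bundles using (CommutativeMonoid)
open import Algebra.Properties.CommutativeSemigroup (CommutativeMonoid.commutativeSemigroup ℚₚ.*-1-commutativeMonoid)
  using () renaming (interchange to ℚ-*-interchange)

fromℚᵘ-homo-* : ∀ x y → ℚ.fromℚᵘ (x ℚᵘ.* y) ≡ ℚ.fromℚᵘ x * ℚ.fromℚᵘ y
fromℚᵘ-homo-* x y = ℚₚ.toℚᵘ-injective (begin
  ℚ.toℚᵘ (ℚ.fromℚᵘ (x ℚᵘ.* y))                    ≈⟨ ℚₚ.toℚᵘ-fromℚᵘ (x ℚᵘ.* y) ⟩
  x ℚᵘ.* y                                       ≈⟨ ℚᵘₚ.*-cong (ℚₚ.toℚᵘ-fromℚᵘ x) (ℚₚ.toℚᵘ-fromℚᵘ y) ⟨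
  ℚ.toℚᵘ (ℚ.fromℚᵘ x) ℚᵘ.* ℚ.toℚᵘ (ℚ.fromℚᵘ y)   ≈⟨ ℚₚ.toℚᵘ-homo-* (ℚ.fromℚᵘ x) (ℚ.fromℚᵘ y) ⟨
  ℚ.toℚᵘ (ℚ.fromℚᵘ x * ℚ.fromℚᵘ y)               ∎)
  where open ℚᵘₚ.≃-Reasoning

/1-homo-* : ∀ a b → (a / 1) * (b / 1) ≡ (a ℤ.* b) / 1
/1-homo-* a b = sym (fromℚᵘ-homo-* (ℚᵘ.mkℚᵘ a 0) (ℚᵘ.mkℚᵘ b 0))

/-*-denominator : ∀ a n → (a / suc n) * toℚ (suc n) ≡ a / 1
/-*-denominator a n = trans (sym (fromℚᵘ-homo-* (ℚᵘ.mkℚᵘ a n) (ℚᵘ.mkℚᵘ (+ suc n) 0)))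
  (ℚₚ.fromℚᵘ-cong {ℚᵘ.mkℚᵘ (a ℤ.* + suc n) (n ℕ.* 1)} {ℚᵘ.mkℚᵘ a 0} (ℚᵘ.*≡* cross))
  where
  cross : (a ℤ.* + suc n) ℤ.* + 1 ≡ a ℤ.* + suc (n ℕ.* 1)
  cross = trans (ℤₚ.*-identityʳ _) (cong (λ d → a ℤ.* + suc d) (sym (ℕₚ.*-identityʳ n)))

toℚ-homo-* : ∀ m n → toℚ (m ℕ.* n) ≡ toℚ m * toℚ n
toℚ-homo-* m n = trans (cong (_/ 1) (ℤₚ.pos-* m n)) (sym (/1-homo-* (+ m) (+ n)))

toℚ-nonZero : ∀ n .{{_ : ℕ.NonZero n}} → ℚ.NonZero (toℚ n)
toℚ-nonZero (suc n) = ℚₚ.pos⇒nonZero (toℚ (suc n)) {{ℚₚ.normalize-pos (suc n) 1}}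

ℚ-*-cancelʳ : ∀ {x y} c .{{_ : ℚ.NonZero c}} → x * c ≡ y * c → x ≡ y
ℚ-*-cancelʳ {x} {y} c xc≡yc = begin
  x                  ≡⟨ ℚₚ.*-identityʳ x ⟨
  x * 1ℚ             ≡⟨ cong (x *_) (ℚₚ.*-inverseʳ c) ⟨
  x * (c * ℚ.1/ c)   ≡⟨ ℚₚ.*-assoc x c _ ⟨
  x * c * ℚ.1/ c     ≡⟨ cong (_* ℚ.1/ c) xc≡yc ⟩
  y * c * ℚ.1/ c     ≡⟨ ℚₚ.*-assoc y c _ ⟩
  y * (c * ℚ.1/ c)   ≡⟨ cong (y *_) (ℚₚ.*-inverseʳ c) ⟩
  y * 1ℚ             ≡⟨ ℚₚ.*-identityʳ y ⟩
  y                  ∎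
  where open ≡-Reasoning

∏ℤ : {A : Set} → (A → ℤ) → List A → ℤ
∏ℤ f xs = foldr ℤ._*_ (+ 1) (map f xs)

module _ {A : Set} where

  ∏ℤ-cong-local : {f g : A → ℤ} {xs : List A} → All (λ x → f x ≡ g x) xs → ∏ℤ f xs ≡ ∏ℤ g xs
  ∏ℤ-cong-local eqs = cong (foldr ℤ._*_ (+ 1)) (map-cong-local eqs)

  ∏ℤ-+ : (f : A → ℕ) (xs : List A) → ∏ℤ (+_ ∘ f) xs ≡ + ∏ f xs
  ∏ℤ-+ f []       = refl
  ∏ℤ-+ f (x ∷ xs) = trans (cong (+ f x ℤ.*_) (∏ℤ-+ f xs)) (sym (ℤₚ.pos-* (f x) (∏ f xs)))

  ∏ℤ-neg : (f : A → ℤ) (xs : List A) → ∏ℤ (-_ ∘ f) xs ≡ (- (+ 1)) ^ length xs ℤ.* ∏ℤ f xs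
  ∏ℤ-neg f []       = refl
  ∏ℤ-neg f (x ∷ xs) = trans (cong (- f x ℤ.*_) (∏ℤ-neg f xs)) (pullSign (f x) ((- (+ 1)) ^ length xs) (∏ℤ f xs))
    where
    pullSign : ∀ a s b → - a ℤ.* (s ℤ.* b) ≡ (- (+ 1)) ℤ.* s ℤ.* (a ℤ.* b)
    pullSign = solve-∀

  -- Denominators are written suc (k u), as hook lengths are by definition, so NonZero is automatic.
  prodℚ-map-/ : (a : A → ℤ) (k : A → ℕ) (xs : List A) →
    prodℚ (map (λ u → a u / suc (k u)) xs) * toℚ (∏ (suc ∘ k) xs) ≡ ∏ℤ a xs / 1
  prodℚ-map-/ a k []       = refl
  prodℚ-map-/ a k (x ∷ xs) = begin
    r x * R * toℚ (suc (k x) ℕ.* ∏ (suc ∘ k) xs)          ≡⟨ cong (r x * R *_) (toℚ-homo-* (suc (k x)) (∏ (suc ∘ k) xs)) ⟩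
    r x * R * (toℚ (suc (k x)) * toℚ (∏ (suc ∘ k) xs))    ≡⟨ ℚ-*-interchange (r x) R (toℚ (suc (k x))) (toℚ (∏ (suc ∘ k) xs)) ⟩
    r x * toℚ (suc (k x)) * (R * toℚ (∏ (suc ∘ k) xs))    ≡⟨ cong₂ _*_ (/-*-denominator (a x) (k x)) (prodℚ-map-/ a k xs) ⟩
    (a x / 1) * (∏ℤ a xs / 1)                             ≡⟨ /1-homo-* (a x) (∏ℤ a xs) ⟩
    (a x ℤ.* ∏ℤ a xs) / 1                                 ∎
    where
    open ≡-Reasoning
    r : A → ℚ
    r u = a u / suc (k u)
    R = prodℚ (map r xs)

sEval-*-H : ∀ λs z → sEval λs z * toℚ (H λs) ≡ ∏ℤ (λ u → z ℤ.+ content u) (squares λs) / 1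
sEval-*-H λs z = trans (cong (λ h → sEval λs z * toℚ h) (H≡∏hook λs)) (prodℚ-map-/ (λ u → z ℤ.+ content u) _ (squares λs))

plus-content : ∀ p {i} j → i ≤ p → + p ℤ.+ content (i , j) ≡ + plusContent p (i , j)
plus-content p {i} j i≤p = begin
  + p ℤ.+ (+ j ℤ.- + i)        ≡⟨ regroup (+ p) (+ j) (+ i) ⟩
  (+ p ℤ.- + i) ℤ.+ + j        ≡⟨ cong (ℤ._+ + j) (trans (ℤₚ.m-n≡m⊖n p i) (ℤₚ.⊖-≥ i≤p)) ⟩
  + (p ℕ.∸ i) ℤ.+ + j          ≡⟨ ℤₚ.pos-+ (p ℕ.∸ i) j ⟨
  + ((p ℕ.∸ i) ℕ.+ j)          ∎
  where
  open ≡-Reasoning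
  regroup : ∀ a b c → a ℤ.+ (b ℤ.- c) ≡ (a ℤ.- c) ℤ.+ b
  regroup = solve-∀

minus-content : ∀ q i {j} → j ≤ q → - (+ q) ℤ.+ content (i , j) ≡ - (+ minusContent q (i , j))
minus-content q i {j} j≤q = begin
  - (+ q) ℤ.+ (+ j ℤ.- + i)    ≡⟨ regroup (+ q) (+ j) (+ i) ⟩
  - ((+ i ℤ.+ + q) ℤ.- + j)    ≡⟨ cong (λ n → - (n ℤ.- + j)) (ℤₚ.pos-+ i q) ⟨
  - (+ (i ℕ.+ q) ℤ.- + j)      ≡⟨ cong -_ (trans (ℤₚ.m-n≡m⊖n (i ℕ.+ q) j) (ℤₚ.⊖-≥ j≤i+q)) ⟩
  - (+ ((i ℕ.+ q) ℕ.∸ j))      ∎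
  where
  open ≡-Reasoning
  regroup : ∀ a b c → - a ℤ.+ (b ℤ.- c) ≡ - ((c ℤ.+ a) ℤ.- b)
  regroup = solve-∀
  j≤i+q : j ≤ i ℕ.+ q
  j≤i+q = ℕₚ.≤-trans j≤q (ℕₚ.m≤n+m q i)

sign² : ∀ n → (- (+ 1)) ^ n ℤ.* (- (+ 1)) ^ n ≡ + 1
sign² n = begin
  (- (+ 1)) ^ n ℤ.* (- (+ 1)) ^ n   ≡⟨ ℤₚ.^-distribˡ-+-* (- (+ 1)) n n ⟨
  (- (+ 1)) ^ (n ℕ.+ n)             ≡⟨ cong (λ m → (- (+ 1)) ^ (n ℕ.+ m)) (ℕₚ.+-identityʳ n) ⟨
  (- (+ 1)) ^ (2 ℕ.* n)             ≡⟨ ℤₚ.^-*-assoc (- (+ 1)) 2 n ⟨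
  (+ 1) ^ n                         ≡⟨ ℤₚ.^-zeroˡ n ⟩
  + 1                               ∎
  where open ≡-Reasoning

sEval-length-*-H : ∀ λs → sEval λs (+ length λs) * toℚ (H λs) ≡ toℚ (∏ (plusContent (length λs)) (squares λs))
sEval-length-*-H λs = trans (sEval-*-H λs (+ length λs)) (cong (_/ 1) (trans
  (∏ℤ-cong-local (All.map plus (squares-IsSquare λs)))
  (∏ℤ-+ (plusContent (length λs)) (squares λs))))
  where
  plus : ∀ {u} → IsSquare λs u → + length λs ℤ.+ content u ≡ + plusContent (length λs) u
  plus {i , j} ((_ , i≤p) , _) = plus-content (length λs) j i≤p

sEval-neg-*-H : ∀ q λs → All (_≤ q) λs →
  ((- (+ 1)) ^ size λs / 1) * (sEval λs (- (+ q)) * toℚ (H λs)) ≡ toℚ (∏ (minusContent q) (squares λs))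
sEval-neg-*-H q λs λs≤q = begin
  (s / 1) * (sEval λs (- (+ q)) * toℚ (H λs))   ≡⟨ cong ((s / 1) *_) (sEval-*-H λs (- (+ q))) ⟩
  (s / 1) * (C / 1)                             ≡⟨ /1-homo-* s C ⟩
  (s ℤ.* C) / 1                                 ≡⟨ cong (λ x → (s ℤ.* x) / 1) negated ⟩
  (s ℤ.* (s ℤ.* + Q)) / 1                       ≡⟨ cong (_/ 1) (ℤₚ.*-assoc s s (+ Q)) ⟨
  (s ℤ.* s ℤ.* + Q) / 1                         ≡⟨ cong (λ x → (x ℤ.* + Q) / 1) (sign² (size λs)) ⟩
  (+ 1 ℤ.* + Q) / 1                             ≡⟨ cong (_/ 1) (ℤₚ.*-identityˡ (+ Q)) ⟩
  toℚ Q                                         ∎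
  where
  open ≡-Reasoning
  s = (- (+ 1)) ^ size λs
  C = ∏ℤ (λ u → - (+ q) ℤ.+ content u) (squares λs)
  Q = ∏ (minusContent q) (squares λs)
  minus : ∀ {u} → IsSquare λs u → - (+ q) ℤ.+ content u ≡ - (+ minusContent q u)
  minus {i , j} (_ , (_ , j≤λᵢ)) = minus-content q i (ℕₚ.≤-trans j≤λᵢ (part-≤ λs λs≤q i))
  negated : C ≡ s ℤ.* + Q
  negated = begin
    C                                                           ≡⟨ ∏ℤ-cong-local (All.map minus (squares-IsSquare λs)) ⟩
    ∏ℤ (-_ ∘ +_ ∘ minusContent q) (squares λs)                  ≡⟨ ∏ℤ-neg (+_ ∘ minusContent q) (squares λs) ⟩
    (- (+ 1)) ^ length (squares λs) ℤ.* ∏ℤ (+_ ∘ minusContent q) (squares λs)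
      ≡⟨ cong₂ (λ n x → (- (+ 1)) ^ n ℤ.* x) (length-squares λs) (∏ℤ-+ (minusContent q) (squares λs)) ⟩
    s ℤ.* + Q                                                   ∎

-- The identity holds for p = 0 or q = 0 as well.
mainTheorem2 : (p q : ℕ) → p ≥ 1 → q ≥ 1 → (λs : List ℕ) → IsPartition λs → length λs ≡ p → All (_≤ q) λs →
    toℚ (H (rect p q)) ≡ (((- (+ 1)) ^ size λs) / 1) * toℚ (H λs) * toℚ (H (complement q λs)) * sEval λs (+ p) * sEval λs (- (+ q))
mainTheorem2 .(length λs) q _ _ λs λs-partition refl λs≤q = ℚ-*-cancelʳ h {{toℚ-nonZero (H λs) {{H-nonZero λs}}}} (begin
  toℚ Hr * h                           ≡⟨ toℚ-homo-* Hr (H λs) ⟨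
  toℚ (Hr ℕ.* H λs)                    ≡⟨ cong toℚ (H-rectangle-*-H q λs λs-decreasing λs≤q) ⟩
  toℚ (Hc ℕ.* P ℕ.* Q)                 ≡⟨ trans (toℚ-homo-* (Hc ℕ.* P) Q) (cong (_* toℚ Q) (toℚ-homo-* Hc P)) ⟩
  toℚ Hc * toℚ P * toℚ Q               ≡⟨ cong₂ (λ x y → toℚ Hc * x * y) (sEval-length-*-H λs) (sEval-neg-*-H q λs λs≤q) ⟨
  toℚ Hc * (sp * h) * (S * (sq * h))   ≡⟨ regroup (toℚ Hc) sp sq S h ⟩
  S * h * toℚ Hc * sp * sq * h         ∎)
  where
  open ≡-Reasoning
  open +-*-Solver
  λs-decreasing : AllPairs _≥_ λs
  λs-decreasing = Linked⇒AllPairs (λ i≥j j≥k → ℕₚ.≤-trans j≥k i≥j) λs-partition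
  Hr Hc P Q : ℕ
  Hr = H (rect (length λs) q)
  Hc = H (complement q λs)
  P  = ∏ (plusContent (length λs)) (squares λs)
  Q  = ∏ (minusContent q) (squares λs)
  h S sp sq : ℚ
  h  = toℚ (H λs)
  S  = ((- (+ 1)) ^ size λs) / 1
  sp = sEval λs (+ length λs)
  sq = sEval λs (- (+ q))
  regroup : ∀ c x y s k → c * (x * k) * (s * (y * k)) ≡ s * k * c * x * y * k
  regroup = solve 5 (λ c x y s k → c :* (x :* k) :* (s :* (y :* k)) := s :* k :* c :* x :* y :* k) refl
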